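{- Let $n\ge1$, $x,y$ coprime with $1\le x<y$, consider the rotor multigraph $P^{x,y}_n$, and let $F=\sum_{i=0}^n x^{n-i}y^i$. Let $v\ge0$ be an integer. Then: (i) if $c[v]_{n+1}<0$, then $v-F\notin g(\mathcal{R})$; (ii) if $c[v]_{n+1}\ge0$, then $v+F\notin g(\mathcal{R})$.
   Context: $P^{x,y}_n$ has vertices $u_0,\dots,u_{n+1}$; $u_0,u_{n+1}$ are sinks and $V_0=\{u_1,\dots,u_n\}$. For $1\le k\le n$, $u_k$ has outgoing arcs $a^k_0,\dots,a^k_{x+y-1}$, with $a^k_i$ going to $u_{k+1}$ for $0\le i\le x-1$ and to $u_{k-1}$ for $x\le i\le x+y-1$. A rotor configuration assigns to each $u\in V_0$ an outgoing arc $\rho(u)$; $\mathcal{R}$ is their set. With $h(u_0)=0$, $h(u_k)=\sum_{i=0}^{k-1}x^{n-i}y^i$, define $g(a^k_j)=\sum_{i=0}^{j-1}\big(h(\mathrm{head}(a^k_i))-h(u_k)\big)$, $g(\rho)=\sum_{u\in V_0}g(\rho(u))$ and $g(\mathcal{R})=\{g(\rho):\rho\in\mathcal{R}\}$. Let $d_k=x^{n-k}y^k$ ($0\le k\le n+1$); for an integer $w\ge0$, $c[w]=(c_0,\dots,c_{n+1})$ is the unique tuple with $w=\sum_{k=0}^{n+1}c_kd_k$, $c_k\in\{0,\dots,y-1\}$ for $k\le n$ and $c_{n+1}\in x\mathbb{Z}$, and $c[w]_{n+1}$ denotes its last coordinate. -}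

module Defs where

open import Data.Nat as ℕ using (ℕ; zero; suc; _∸_; _<ᵇ_)
open import Data.Bool using (if_then_else_)
open import Data.Fin using (Fin; toℕ)
import Data.Fin as Fin
open import Data.Integer using (ℤ; +_; 0ℤ; _+_; _-_; _*_)
open import Data.Integer.Divisibility using (_∣_)
open import Data.Product using (_×_; ∃)
open import Relation.Binary.PropositionalEquality using (_≡_)

Σ< : ℕ → (ℕ → ℤ) → ℤ
Σ< zero    f = 0ℤ
Σ< (suc k) f = Σ< k f + f k

ΣFin : (m : ℕ) → (Fin m → ℤ) → ℤ
ΣFin zero    f = 0ℤ
ΣFin (suc m) f = f Fin.zero + ΣFin m (λ k → f (Fin.suc k))

-- The graph P^{x,y}_n : vertex u_k is represented by the index k ∈ {0,…,n+1}.
-- h(u_k) = Σ_{i=0}^{k-1} x^{n-i} y^i   (so h(u_0) = 0)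
h : (n x y : ℕ) → ℕ → ℤ
h n x y k = Σ< k (λ i → + (x ℕ.^ (n ∸ i) ℕ.* y ℕ.^ i))

-- head of arc a^k_i : u_{k+1} if i < x, u_{k-1} otherwise (k ≥ 1)
headArc : (x k i : ℕ) → ℕ
headArc x k i = if i <ᵇ x then suc k else k ∸ 1

gArc : (n x y : ℕ) → (k j : ℕ) → ℤ
gArc n x y k j = Σ< j (λ i → h n x y (headArc x k i) - h n x y k)

-- Rotor configuration: vertex u_{k+1} (k : Fin n) ↦ index j of its arc a^{k+1}_j, j < x+y
Rotor : (n x y : ℕ) → Set
Rotor n x y = Fin n → Fin (x ℕ.+ y)

gRot : (n x y : ℕ) → Rotor n x y → ℤ
gRot n x y ρ = ΣFin n (λ k → gArc n x y (suc (toℕ k)) (toℕ (ρ k)))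

InGR : (n x y : ℕ) → ℤ → Set
InGR n x y z = ∃ λ (ρ : Rotor n x y) → gRot n x y ρ ≡ z

F : (n x y : ℕ) → ℤ
F n x y = Σ< (suc n) (λ i → + (x ℕ.^ (n ∸ i) ℕ.* y ℕ.^ i))

-- IsC n x y w c c' : (c_0,…,c_n, c') is the tuple c[w], i.e.
--   c_k ∈ {0,…,y-1} (k ≤ n),  c' = c_{n+1} ∈ xℤ,
--   w = Σ_{k=0}^{n} c_k x^{n-k} y^k + c' · y^{n+1}/x,
-- where the equation is multiplied through by x to stay in ℤ
-- (d_{n+1} = y^{n+1}/x is not an integer).
IsC : (n x y w : ℕ) → (Fin (suc n) → ℕ) → ℤ → Set
IsC n x y w c c' =
  (∀ k → c k ℕ.< y) ×
  (+ x ∣ c') ×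
  (+ x * + w ≡ ΣFin (suc n) (λ k → + (c k ℕ.* x ℕ.^ (suc n ∸ toℕ k) ℕ.* y ℕ.^ toℕ k))
               + c' * + (y ℕ.^ suc n))

{-# OPTIONS --safe #-}
-- Multiply by x: then every quantity is an integer written in the mixed radix with
-- weights x^(n+1-i) y^i (0 ≤ i ≤ n+1).  The digits of x·v are c_0, …, c_n, c', those of
-- x·F are 1, …, 1, 0, and those of x·g(ρ) are a_i ≥ 0, where a_i collects the backward
-- part of the rotor at u_(i+1) and the forward part of the rotor at u_i.  Two digit
-- strings of equal value differ by carries: as y is coprime to x, the lowest digits agree
-- modulo y, a_0 = c_0 + q y, and q x moves on to the next digit.
-- If g(ρ) = v - F we compare c_i - 1 < y with a_i ≥ 0: every carry is ≥ 0, so c' ≥ 0.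
-- If g(ρ) = v + F we compare c_i + 1 > 0 with a_i: every carry is ≤ 0, and ≤ -1 out of a
-- digit whose rotor points forward; digit n has no backward part, so c' ≤ -1.
module Submission where

open import Defs
open import Data.Nat using (ℕ; suc; _≤_; _<_)
open import Data.Nat.Coprimality using (Coprime)
open import Data.Fin using (Fin)
open import Data.Integer using (ℤ; +_; 0ℤ; _+_; _-_)
import Data.Integer as ℤ
open import Data.Product using (_×_)
open import Relation.Nullary using (¬_)
open import Relation.Nullary using (yes; no)

open import Data.Nat as ℕ using (zero; _∸_; _^_; _<ᵇ_; z≤n; s≤s; NonZero)
import Data.Nat.Properties as ℕP
import Data.Nat.Coprimality as ℕC
open import Data.Fin as Fin using (toℕ)
open import Data.Fin.Properties using (toℕ<n)
open import Data.Integer using (1ℤ; -1ℤ; _*_; -_; +≤+; +<+)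
open import Data.Integer.Properties
import Data.Integer.Divisibility as Unsigned
open import Data.Integer.Divisibility.Signed as Signed using (divides; ∣ᵤ⇒∣; ∣⇒∣ᵤ)
open import Data.Integer.Coprimality using (coprime-divisor)
open import Data.Integer.Tactic.RingSolver using (solve-∀)
open import Data.Product using (_,_)
open import Data.Sum using (_⊎_; inj₁; inj₂)
open import Function using (_∘_)
open import Data.Bool using (if_then_else_)
open import Relation.Nullary.Reflects using (det; ofʸ; ofⁿ)
open import Relation.Binary.PropositionalEquality
import Algebra.Properties.CommutativeSemigroup as CommutativeSemigroupProperties
module ℤ+ = CommutativeSemigroupProperties +-commutativeSemigroup
module ℤ* = CommutativeSemigroupProperties *-commutativeSemigroup
module ℕ* = CommutativeSemigroupProperties ℕP.*-commutativeSemigroup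

extend : ∀ {A : Set} {L} → A → (Fin L → A) → ℕ → A
extend {L = zero}  d f i       = d
extend {L = suc L} d f zero    = f Fin.zero
extend {L = suc L} d f (suc i) = extend d (f ∘ Fin.suc) i

extend-toℕ : ∀ {A : Set} {L} (d : A) (f : Fin L → A) k → extend d f (toℕ k) ≡ f k
extend-toℕ d f Fin.zero    = refl
extend-toℕ d f (Fin.suc k) = extend-toℕ d (f ∘ Fin.suc) k

extend-≥ : ∀ {A : Set} {L i} (d : A) (f : Fin L → A) → L ≤ i → extend d f i ≡ d
extend-≥ {L = zero}              d f L≤i       = refl
extend-≥ {L = suc L} {i = suc i} d f (s≤s L≤i) = extend-≥ d (f ∘ Fin.suc) L≤i

-≡⇒≡+ : ∀ {i j k} → i - j ≡ k → i ≡ j + k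
-≡⇒≡+ {i} {j} refl = i≡j+[i-j] i j
  where
  i≡j+[i-j] : ∀ i j → i ≡ j + (i - j)
  i≡j+[i-j] = solve-∀

if-< : ∀ {A : Set} {m n} {a b : A} → m < n → (if m <ᵇ n then a else b) ≡ a
if-< {m = m} {n} {a} {b} m<n = cong (if_then a else b) (det (ℕP.<ᵇ-reflects-< m n) (ofʸ m<n))

if-≥ : ∀ {A : Set} {m n} {a b : A} → n ≤ m → (if m <ᵇ n then a else b) ≡ b
if-≥ {m = m} {n} {a} {b} n≤m = cong (if_then a else b) (det (ℕP.<ᵇ-reflects-< m n) (ofⁿ (ℕP.≤⇒≯ n≤m)))

Σ<-front : ∀ m (f : ℕ → ℤ) → Σ< (suc m) f ≡ f 0 + Σ< m (f ∘ suc)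
Σ<-front zero    f = trans (+-identityˡ (f 0)) (sym (+-identityʳ (f 0)))
Σ<-front (suc m) f = trans (cong (_+ f (suc m)) (Σ<-front m f)) (+-assoc (f 0) _ _)

Σ<-cong : ∀ m {f g : ℕ → ℤ} → (∀ i → i < m → f i ≡ g i) → Σ< m f ≡ Σ< m g
Σ<-cong zero    f≗g = refl
Σ<-cong (suc m) f≗g = cong₂ _+_ (Σ<-cong m (λ i i<m → f≗g i (ℕP.m<n⇒m<1+n i<m))) (f≗g m ℕP.≤-refl)

Σ<-+ : ∀ m (f g : ℕ → ℤ) → Σ< m (λ i → f i + g i) ≡ Σ< m f + Σ< m g
Σ<-+ zero    f g = refl
Σ<-+ (suc m) f g = trans (cong (_+ (f m + g m)) (Σ<-+ m f g)) (ℤ+.interchange (Σ< m f) (Σ< m g) (f m) (g m))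

Σ<-* : ∀ m k (f : ℕ → ℤ) → Σ< m (λ i → k * f i) ≡ k * Σ< m f
Σ<-* zero    k f = sym (*-zeroʳ k)
Σ<-* (suc m) k f = trans (cong (_+ k * f m) (Σ<-* m k f)) (sym (*-distribˡ-+ k _ _))

Σ<-reindex : ∀ m (f g : ℕ → ℤ) →
             Σ< (suc m) (λ i → f i + g i) ≡ Σ< m (λ i → f i + g (suc i)) + (f m + g 0)
Σ<-reindex m f g = begin
  Σ< (suc m) (λ i → f i + g i)                  ≡⟨ Σ<-+ (suc m) f g ⟩
  (Σ< m f + f m) + Σ< (suc m) g                 ≡⟨ cong (λ t → (Σ< m f + f m) + t) (Σ<-front m g) ⟩
  (Σ< m f + f m) + (g 0 + Σ< m (g ∘ suc))       ≡⟨ shuffle (Σ< m f) (f m) (g 0) (Σ< m (g ∘ suc)) ⟩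
  (Σ< m f + Σ< m (g ∘ suc)) + (f m + g 0)       ≡⟨ cong (_+ (f m + g 0)) (Σ<-+ m f (g ∘ suc)) ⟨
  Σ< m (λ i → f i + g (suc i)) + (f m + g 0)    ∎
  where
  open ≡-Reasoning
  shuffle : ∀ a b c d → (a + b) + (c + d) ≡ (a + d) + (b + c)
  shuffle = solve-∀

ΣFin≡Σ< : ∀ m {f : Fin m → ℤ} {g : ℕ → ℤ} → (∀ k → f k ≡ g (toℕ k)) → ΣFin m f ≡ Σ< m g
ΣFin≡Σ< zero    f≗g = refl
ΣFin≡Σ< (suc m) {g = g} f≗g =
  trans (cong₂ _+_ (f≗g Fin.zero) (ΣFin≡Σ< m (f≗g ∘ Fin.suc))) (sym (Σ<-front m g))

ΣFin-+ : ∀ m (f g : Fin m → ℤ) → ΣFin m (λ k → f k + g k) ≡ ΣFin m f + ΣFin m g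
ΣFin-+ zero    f g = refl
ΣFin-+ (suc m) f g = trans (cong (λ t → f Fin.zero + g Fin.zero + t) (ΣFin-+ m (f ∘ Fin.suc) (g ∘ Fin.suc)))
                           (ℤ+.interchange (f Fin.zero) (g Fin.zero) _ _)

ΣFin-* : ∀ m k (f : Fin m → ℤ) → ΣFin m (λ i → k * f i) ≡ k * ΣFin m f
ΣFin-* zero    k f = sym (*-zeroʳ k)
ΣFin-* (suc m) k f = trans (cong (λ t → k * f Fin.zero + t) (ΣFin-* m k (f ∘ Fin.suc))) (sym (*-distribˡ-+ k _ _))

-- Mixed-radix digit strings and carries

module MixedRadix (x y : ℕ) where

  weight : ℕ → ℕ → ℤ
  weight L i = + (x ^ (L ∸ i) ℕ.* y ^ i)

  value : ℕ → (ℕ → ℤ) → ℤ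
  value L a = Σ< (suc L) (λ i → a i * weight L i)

  addToHead : ℤ → (ℕ → ℤ) → ℕ → ℤ
  addToHead t a zero    = a 0 + t
  addToHead t a (suc i) = a (suc i)

  x*x^[L∸i] : ∀ {L i} → i ≤ L → x ℕ.* x ^ (L ∸ i) ≡ x ^ (suc L ∸ i)
  x*x^[L∸i] i≤L = cong (x ^_) (sym (ℕP.+-∸-assoc 1 i≤L))

  weight-scale : ∀ {L i} → i ≤ L → + x * weight L i ≡ weight (suc L) i
  weight-scale {L} {i} i≤L = begin
    + x * + (x ^ (L ∸ i) ℕ.* y ^ i)     ≡⟨ pos-* x _ ⟨
    + (x ℕ.* (x ^ (L ∸ i) ℕ.* y ^ i))   ≡⟨ cong +_ (ℕP.*-assoc x _ _) ⟨
    + (x ℕ.* x ^ (L ∸ i) ℕ.* y ^ i)     ≡⟨ cong (λ e → + (e ℕ.* y ^ i)) (x*x^[L∸i] i≤L) ⟩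
    weight (suc L) i                    ∎
    where open ≡-Reasoning

  weight-suc : ∀ L i → weight (suc L) (suc i) ≡ + y * weight L i
  weight-suc L i = trans (cong +_ (ℕ*.x∙yz≈y∙xz (x ^ (L ∸ i)) y (y ^ i))) (pos-* y _)

  weight-carry : ∀ {L i} → i < L → + x * weight L (suc i) ≡ + y * weight L i
  weight-carry {suc L} {i} (s≤s i≤L) = begin
    + x * weight (suc L) (suc i)   ≡⟨ cong (+ x *_) (weight-suc L i) ⟩
    + x * (+ y * weight L i)       ≡⟨ ℤ*.x∙yz≈y∙xz (+ x) (+ y) _ ⟩
    + y * (+ x * weight L i)       ≡⟨ cong (+ y *_) (weight-scale i≤L) ⟩
    + y * weight (suc L) i         ∎
    where open ≡-Reasoning

  weight-diag : ∀ L → weight L L ≡ + (y ^ L)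
  weight-diag L = cong +_ (trans (cong (λ e → x ^ e ℕ.* y ^ L) (ℕP.n∸n≡0 L)) (ℕP.*-identityˡ (y ^ L)))

  value-zero : ∀ a → value 0 a ≡ a 0
  value-zero a = trans (+-identityˡ _) (*-identityʳ (a 0))

  value-suc : ∀ L a → value (suc L) a ≡ a 0 * + (x ^ suc L) + + y * value L (a ∘ suc)
  value-suc L a = begin
    value (suc L) a
      ≡⟨ Σ<-front (suc L) _ ⟩
    a 0 * + (x ^ suc L ℕ.* 1) + Σ< (suc L) (λ i → a (suc i) * weight (suc L) (suc i))
      ≡⟨ cong₂ (λ e s → a 0 * + e + s) (ℕP.*-identityʳ _) (Σ<-cong (suc L) (λ i _ → shift i)) ⟩
    a 0 * + (x ^ suc L) + Σ< (suc L) (λ i → + y * (a (suc i) * weight L i))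
      ≡⟨ cong (λ s → a 0 * + (x ^ suc L) + s) (Σ<-* (suc L) (+ y) _) ⟩
    a 0 * + (x ^ suc L) + + y * value L (a ∘ suc) ∎
    where
    open ≡-Reasoning
    shift : ∀ i → a (suc i) * weight (suc L) (suc i) ≡ + y * (a (suc i) * weight L i)
    shift i = trans (cong (a (suc i) *_) (weight-suc L i)) (ℤ*.x∙yz≈y∙xz (a (suc i)) (+ y) _)

  value-addToHead : ∀ L t a → value L (addToHead t a) ≡ value L a + t * + (x ^ L)
  value-addToHead L t a = begin
    value L (addToHead t a)                  ≡⟨ Σ<-front L _ ⟩
    (a 0 + t) * w₀ + rest                    ≡⟨ regroup (a 0) t w₀ rest ⟩
    (a 0 * w₀ + rest) + t * w₀               ≡⟨ cong₂ (λ v e → v + t * + e) (Σ<-front L _) (sym (ℕP.*-identityʳ _)) ⟨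
    value L a + t * + (x ^ L)                ∎
    where
    open ≡-Reasoning
    w₀ rest : ℤ
    w₀ = weight L 0
    rest = Σ< L (λ i → a (suc i) * weight L (suc i))
    regroup : ∀ a t w r → (a + t) * w + r ≡ (a * w + r) + t * w
    regroup = solve-∀

  -- r i bounds digit i of a after the incoming carry: when r i ≤ 0 the carry out of
  -- digit i is at most -1, which lets digit i + 1 exceed its bound by x.
  CarryBounded : (a r : ℕ → ℤ) → ℕ → Set
  CarryBounded a r i = (r i ℤ.≤ 0ℤ × a (suc i) ℤ.≤ r (suc i) + + x) ⊎ (r i ℤ.≤ + y × a (suc i) ℤ.≤ r (suc i))

  module _ .{{_ : NonZero y}} (x⊥y : Coprime x y) where

    coprime-divisor-^ : ∀ k o → + y Unsigned.∣ + (x ^ k) * o → + y Unsigned.∣ o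
    coprime-divisor-^ zero    o y∣o      = subst (+ y Unsigned.∣_) (*-identityˡ o) y∣o
    coprime-divisor-^ (suc k) o y∣x^k+1o = coprime-divisor-^ k o
      (coprime-divisor (+ y) (+ x) _ (ℕC.sym x⊥y)
        (subst (+ y Unsigned.∣_) (trans (cong (_* o) (pos-* x (x ^ k))) (*-assoc (+ x) _ o)) y∣x^k+1o))

    record Carry (L : ℕ) (c a : ℕ → ℤ) : Set where
      field
        q     : ℤ
        head≡ : a 0 ≡ c 0 + q * + y
        tail≡ : value L (c ∘ suc) ≡ value L (addToHead (q * + x) (a ∘ suc))

    carry : ∀ L c a → value (suc L) c ≡ value (suc L) a → Carry L c a
    carry L c a eq = fromQuotient (∣ᵤ⇒∣ (coprime-divisor-^ (suc L) (a 0 - c 0) (∣⇒∣ᵤ (divides (C - A) balance))))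
      where
      open ≡-Reasoning
      X C A : ℤ
      X = + (x ^ suc L)
      C = value L (c ∘ suc)
      A = value L (a ∘ suc)

      balance : X * (a 0 - c 0) ≡ (C - A) * + y
      balance = begin
        X * (a 0 - c 0)                           ≡⟨ lhs (a 0) (c 0) X (+ y) A ⟩
        (a 0 * X + + y * A) - (c 0 * X + + y * A) ≡⟨ cong (_- (c 0 * X + + y * A)) (trans (sym (value-suc L a)) (trans (sym eq) (value-suc L c))) ⟩
        (c 0 * X + + y * C) - (c 0 * X + + y * A) ≡⟨ rhs (c 0) X (+ y) C A ⟩
        (C - A) * + y                             ∎
        where
        lhs : ∀ a c X y A → X * (a - c) ≡ (a * X + y * A) - (c * X + y * A)
        lhs = solve-∀
        rhs : ∀ c X y C A → (c * X + y * C) - (c * X + y * A) ≡ (C - A) * y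
        rhs = solve-∀

      fromQuotient : + y Signed.∣ (a 0 - c 0) → Carry L c a
      fromQuotient (divides q a₀-c₀≡qy) = record { q = q ; head≡ = -≡⇒≡+ a₀-c₀≡qy ; tail≡ = begin
        C                                       ≡⟨ -≡⇒≡+ (*-cancelʳ-≡ (C - A) (q * X) (+ y) carried) ⟩
        A + q * X                               ≡⟨ cong (λ e → A + q * e) (pos-* x (x ^ L)) ⟩
        A + q * (+ x * + (x ^ L))               ≡⟨ cong (λ e → A + e) (*-assoc q (+ x) _) ⟨
        A + q * + x * + (x ^ L)                 ≡⟨ value-addToHead L (q * + x) (a ∘ suc) ⟨
        value L (addToHead (q * + x) (a ∘ suc)) ∎ }
        where
        carried : (C - A) * + y ≡ q * X * + y
        carried = begin
          (C - A) * + y   ≡⟨ balance ⟨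
          X * (a 0 - c 0) ≡⟨ cong (X *_) a₀-c₀≡qy ⟩
          X * (q * + y)   ≡⟨ ℤ*.x∙yz≈yx∙z X q (+ y) ⟩
          q * X * + y     ∎

    top-digit-nonneg : ∀ L (c a : ℕ → ℤ) → (∀ (k : Fin L) → c (toℕ k) ℤ.< + y) → (∀ i → 0ℤ ℤ.≤ a i) →
                       value L c ≡ value L a → 0ℤ ℤ.≤ c L
    top-digit-nonneg zero    c a c<y a≥0 eq =
      subst (0ℤ ℤ.≤_) (trans (sym (value-zero a)) (trans (sym eq) (value-zero c))) (a≥0 0)
    top-digit-nonneg (suc L) c a c<y a≥0 eq =
      top-digit-nonneg L (c ∘ suc) (addToHead (q * + x) (a ∘ suc)) (c<y ∘ Fin.suc) a'≥0 tail≡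
      where
      open Carry (carry L c a eq)
      q≥0 : 0ℤ ℤ.≤ q
      q≥0 = i<j⇒suc[i]≤j (*-cancelʳ-<-nonNeg { -1ℤ} {q} (+ y) (begin-strict
        -1ℤ * + y   ≡⟨ -1*i≡-i (+ y) ⟩
        - + y       <⟨ neg-mono-< (c<y Fin.zero) ⟩
        - c 0       ≡⟨ +-identityˡ (- c 0) ⟨
        0ℤ - c 0    ≤⟨ +-monoˡ-≤ (- c 0) (a≥0 0) ⟩
        a 0 - c 0   ≡⟨ cong (_- c 0) head≡ ⟩
        c 0 + q * + y - c 0 ≡⟨ cancel (c 0) (q * + y) ⟩
        q * + y     ∎))
        where
        open ≤-Reasoning
        cancel : ∀ c t → c + t - c ≡ t
        cancel = solve-∀
      a'≥0 : ∀ i → 0ℤ ℤ.≤ addToHead (q * + x) (a ∘ suc) i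
      a'≥0 zero    = +-mono-≤ (a≥0 1) (*-monoʳ-≤-nonNeg (+ x) q≥0)
      a'≥0 (suc i) = a≥0 (suc (suc i))

    top-digit-bounded : ∀ L (c a r : ℕ → ℤ) → (∀ (k : Fin L) → 0ℤ ℤ.< c (toℕ k)) → a 0 ℤ.≤ r 0 →
                        (∀ i → CarryBounded a r i) → value L c ≡ value L a → c L ℤ.≤ r L
    top-digit-bounded zero    c a r c>0 a₀≤r₀ bounded eq =
      subst (ℤ._≤ r 0) (trans (sym (value-zero a)) (trans (sym eq) (value-zero c))) a₀≤r₀
    top-digit-bounded (suc L) c a r c>0 a₀≤r₀ bounded eq =
      top-digit-bounded L (c ∘ suc) (addToHead (q * + x) (a ∘ suc)) (r ∘ suc) (c>0 ∘ Fin.suc)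
        (next-head (bounded 0)) (bounded ∘ suc) tail≡
      where
      open Carry (carry L c a eq)
      qy<r₀ : q * + y ℤ.< r 0
      qy<r₀ = begin-strict
        q * + y        ≡⟨ +-identityˡ (q * + y) ⟨
        0ℤ + q * + y   <⟨ +-monoˡ-< (q * + y) (c>0 Fin.zero) ⟩
        c 0 + q * + y  ≡⟨ head≡ ⟨
        a 0            ≤⟨ a₀≤r₀ ⟩
        r 0            ∎
        where open ≤-Reasoning
      next-head : CarryBounded a r 0 → a 1 + q * + x ℤ.≤ r 1
      next-head (inj₁ (r₀≤0 , a₁≤r₁+x)) = begin
        a 1 + q * + x        ≤⟨ +-mono-≤ a₁≤r₁+x (*-monoʳ-≤-nonNeg (+ x) q≤-1) ⟩
        r 1 + + x + -1ℤ * + x ≡⟨ cancel (r 1) (+ x) ⟩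
        r 1                  ∎
        where
        open ≤-Reasoning
        q≤-1 : q ℤ.≤ -1ℤ
        q≤-1 = i<j⇒i≤pred[j] (*-cancelʳ-<-nonNeg {q} {0ℤ} (+ y) (<-≤-trans qy<r₀ r₀≤0))
        cancel : ∀ r x → r + x + -1ℤ * x ≡ r
        cancel = solve-∀
      next-head (inj₂ (r₀≤y , a₁≤r₁)) = begin
        a 1 + q * + x        ≤⟨ +-mono-≤ a₁≤r₁ (*-monoʳ-≤-nonNeg (+ x) q≤0) ⟩
        r 1 + 0ℤ             ≡⟨ +-identityʳ (r 1) ⟩
        r 1                  ∎
        where
        open ≤-Reasoning
        q≤0 : q ℤ.≤ 0ℤ
        q≤0 = i<j⇒i≤pred[j] (*-cancelʳ-<-nonNeg {q} {1ℤ} (+ y)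
                (<-≤-trans qy<r₀ (≤-trans r₀≤y (≤-reflexive (sym (*-identityˡ (+ y)))))))

-- Rotor configurations of P^{x,y}_n as digit strings

module PathGraph (n x y : ℕ) .{{_ : NonZero x}} where
  open MixedRadix x y

  back fwd : ℕ → ℕ
  back j = if j <ᵇ x then 0 else y ∸ (j ∸ x)
  fwd  j = if j <ᵇ x then j else 0

  back≤y : ∀ j → back j ≤ y
  back≤y j with j ℕ.<? x
  ... | yes j<x = subst (_≤ y) (sym (if-< j<x)) z≤n
  ... | no  j≮x = subst (_≤ y) (sym (if-≥ (ℕP.≮⇒≥ j≮x))) (ℕP.m∸n≤m y (j ∸ x))

  gArc-< : ∀ k j → j ≤ x → gArc n x y (suc k) j ≡ + j * weight n (suc k)
  gArc-< k zero    _   = refl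
  gArc-< k (suc j) j<x = begin
    gArc n x y (suc k) j + (h n x y (headArc x (suc k) j) - h n x y (suc k))
      ≡⟨ cong₂ (λ g v → g + (h n x y v - h n x y (suc k))) (gArc-< k j (ℕP.<⇒≤ j<x)) (if-< j<x) ⟩
    + j * weight n (suc k) + ((h n x y (suc k) + weight n (suc k)) - h n x y (suc k))
      ≡⟨ step (+ j) (weight n (suc k)) (h n x y (suc k)) ⟩
    + suc j * weight n (suc k) ∎
    where
    open ≡-Reasoning
    step : ∀ j w H → j * w + ((H + w) - H) ≡ (+ 1 + j) * w
    step = solve-∀

  gArc-≥ : ∀ k t → gArc n x y (suc k) (x ℕ.+ t) ≡ + x * weight n (suc k) - + t * weight n k
  gArc-≥ k zero = begin
    gArc n x y (suc k) (x ℕ.+ 0)  ≡⟨ cong (gArc n x y (suc k)) (ℕP.+-identityʳ x) ⟩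
    gArc n x y (suc k) x          ≡⟨ gArc-< k x ℕP.≤-refl ⟩
    + x * weight n (suc k)        ≡⟨ +-identityʳ _ ⟨
    + x * weight n (suc k) - + 0 * weight n k ∎
    where open ≡-Reasoning
  gArc-≥ k (suc t) = begin
    gArc n x y (suc k) (x ℕ.+ suc t)
      ≡⟨ cong (gArc n x y (suc k)) (ℕP.+-suc x t) ⟩
    gArc n x y (suc k) (x ℕ.+ t) + (h n x y (headArc x (suc k) (x ℕ.+ t)) - h n x y (suc k))
      ≡⟨ cong₂ (λ g v → g + (h n x y v - h n x y (suc k))) (gArc-≥ k t) (if-≥ (ℕP.m≤m+n x t)) ⟩
    (+ x * weight n (suc k) - + t * weight n k) + (h n x y k - (h n x y k + weight n k))
      ≡⟨ step (+ x * weight n (suc k)) (+ t) (weight n k) (h n x y k) ⟩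
    + x * weight n (suc k) - + suc t * weight n k ∎
    where
    open ≡-Reasoning
    step : ∀ A t w H → (A - t * w) + (H - (H + w)) ≡ A - (+ 1 + t) * w
    step = solve-∀

  arc-value : ∀ {k j} → k < n → j < x ℕ.+ y →
              + x * gArc n x y (suc k) j ≡ + back j * weight (suc n) k + + fwd j * weight (suc n) (suc k)
  arc-value {k} {j} k<n j<x+y with j ℕ.<? x
  ... | yes j<x = begin
    + x * gArc n x y (suc k) j          ≡⟨ cong (+ x *_) (gArc-< k j (ℕP.<⇒≤ j<x)) ⟩
    + x * (+ j * weight n (suc k))      ≡⟨ ℤ*.x∙yz≈y∙xz (+ x) (+ j) _ ⟩
    + j * (+ x * weight n (suc k))      ≡⟨ cong (+ j *_) (weight-scale k<n) ⟩
    + j * weight (suc n) (suc k)        ≡⟨ +-identityˡ _ ⟨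
    + 0 * weight (suc n) k + + j * weight (suc n) (suc k)
      ≡⟨ cong₂ (λ b f → + b * weight (suc n) k + + f * weight (suc n) (suc k)) (if-< j<x) (if-< j<x) ⟨
    + back j * weight (suc n) k + + fwd j * weight (suc n) (suc k) ∎
    where open ≡-Reasoning
  ... | no j≮x with ℕP.m≤n⇒∃[o]m+o≡n (ℕP.≮⇒≥ j≮x)
  ...   | t , refl = begin
    + x * gArc n x y (suc k) (x ℕ.+ t)
      ≡⟨ cong (+ x *_) (gArc-≥ k t) ⟩
    + x * (+ x * weight n (suc k) - + t * weight n k)
      ≡⟨ distrib (+ x) (+ x * weight n (suc k)) (+ t) (weight n k) ⟩
    + x * (+ x * weight n (suc k)) - + t * (+ x * weight n k)
      ≡⟨ cong₂ (λ u v → + x * u - + t * v) (weight-scale k<n) (weight-scale (ℕP.<⇒≤ k<n)) ⟩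
    + x * weight (suc n) (suc k) - + t * weight (suc n) k
      ≡⟨ cong (_- + t * weight (suc n) k) (weight-carry (ℕP.m<n⇒m<1+n k<n)) ⟩
    + y * weight (suc n) k - + t * weight (suc n) k
      ≡⟨ factor (+ y) (+ t) (weight (suc n) k) ⟩
    (+ y - + t) * weight (suc n) k
      ≡⟨ cong (_* weight (suc n) k) (trans (m-n≡m⊖n y t) (⊖-≥ t≤y)) ⟩
    + (y ∸ t) * weight (suc n) k
      ≡⟨ +-identityʳ _ ⟨
    + (y ∸ t) * weight (suc n) k + + 0 * weight (suc n) (suc k)
      ≡⟨ cong₂ (λ b f → + b * weight (suc n) k + + f * weight (suc n) (suc k))
               (trans (if-≥ x≤x+t) (cong (y ∸_) (ℕP.m+n∸m≡n x t))) (if-≥ x≤x+t) ⟨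
    + back (x ℕ.+ t) * weight (suc n) k + + fwd (x ℕ.+ t) * weight (suc n) (suc k) ∎
    where
    open ≡-Reasoning
    x≤x+t : x ≤ x ℕ.+ t
    x≤x+t = ℕP.m≤m+n x t
    t≤y : t ≤ y
    t≤y = ℕP.<⇒≤ (ℕP.+-cancelˡ-< x t y j<x+y)
    distrib : ∀ x A t w → x * (A - t * w) ≡ x * A - t * (x * w)
    distrib = solve-∀
    factor : ∀ y t w → y * w - t * w ≡ (y - t) * w
    factor = solve-∀

  x*F : + x * F n x y ≡ Σ< (suc n) (weight (suc n))
  x*F = trans (sym (Σ<-* (suc n) (+ x) (weight n))) (Σ<-cong (suc n) (λ i i≤n → weight-scale (ℕP.≤-pred i≤n)))

  shiftedDigits : (Fin (suc n) → ℕ) → ℤ → ℤ → ℕ → ℤ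
  shiftedDigits c c' s = extend c' (λ k → + c k + s)

  value-shiftedDigits : ∀ {v c c'} → IsC n x y v c c' → ∀ s →
                        value (suc n) (shiftedDigits c c' s) ≡ + x * (+ v + s * F n x y)
  value-shiftedDigits {v} {c} {c'} (_ , _ , x*v≡) s = sym (begin
    + x * (+ v + s * F n x y)            ≡⟨ distrib (+ x) (+ v) s (F n x y) ⟩
    + x * + v + s * (+ x * F n x y)      ≡⟨ cong₂ (λ u f → u + s * f) x*v≡ x*F ⟩
    (Σc + c' * + (y ^ suc n)) + s * ΣW   ≡⟨ swap Σc (c' * + (y ^ suc n)) (s * ΣW) ⟩
    (Σc + s * ΣW) + c' * + (y ^ suc n)   ≡⟨ cong₂ _+_ low top ⟩
    value (suc n) cc                     ∎)
    where
    open ≡-Reasoning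
    W : ℕ → ℤ
    W = weight (suc n)
    cc : ℕ → ℤ
    cc = shiftedDigits c c' s
    term : Fin (suc n) → ℤ
    term k = + (c k ℕ.* x ^ (suc n ∸ toℕ k) ℕ.* y ^ toℕ k)
    Σc ΣW : ℤ
    Σc = ΣFin (suc n) term
    ΣW = Σ< (suc n) W
    distrib : ∀ x v s f → x * (v + s * f) ≡ x * v + s * (x * f)
    distrib = solve-∀
    swap : ∀ a b c → (a + b) + c ≡ (a + c) + b
    swap = solve-∀
    shifted-term : ∀ k → term k + s * W (toℕ k) ≡ cc (toℕ k) * W (toℕ k)
    shifted-term k = begin
      term k + s * W (toℕ k)             ≡⟨ cong (λ e → e + s * W (toℕ k)) (trans (cong +_ (ℕP.*-assoc (c k) _ _)) (pos-* (c k) _)) ⟩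
      + c k * W (toℕ k) + s * W (toℕ k)  ≡⟨ *-distribʳ-+ (W (toℕ k)) (+ c k) s ⟨
      (+ c k + s) * W (toℕ k)            ≡⟨ cong (_* W (toℕ k)) (extend-toℕ c' (λ k → + c k + s) k) ⟨
      cc (toℕ k) * W (toℕ k)             ∎
    low : Σc + s * ΣW ≡ Σ< (suc n) (λ i → cc i * W i)
    low = begin
      Σc + s * ΣW                              ≡⟨ cong (λ t → Σc + s * t) (ΣFin≡Σ< (suc n) (λ _ → refl)) ⟨
      Σc + s * ΣFin (suc n) (W ∘ toℕ)          ≡⟨ cong (λ t → Σc + t) (ΣFin-* (suc n) s (W ∘ toℕ)) ⟨
      Σc + ΣFin (suc n) (λ k → s * W (toℕ k))  ≡⟨ ΣFin-+ (suc n) term (λ k → s * W (toℕ k)) ⟨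
      ΣFin (suc n) (λ k → term k + s * W (toℕ k)) ≡⟨ ΣFin≡Σ< (suc n) shifted-term ⟩
      Σ< (suc n) (λ i → cc i * W i)            ∎
    top : c' * + (y ^ suc n) ≡ cc (suc n) * W (suc n)
    top = sym (cong₂ _*_ (extend-≥ c' (λ k → + c k + s) ℕP.≤-refl) (weight-diag (suc n)))

  0<x : 0 < x
  0<x = ℕ.>-nonZero⁻¹ x

  module _ (ρ : Rotor n x y) where

    -- arcIndex i is the index of the arc ρ(u_(i+1)); past u_n it is the forward arc 0,
    -- which contributes nothing.
    arcIndex : ℕ → ℕ
    arcIndex = extend 0 (toℕ ∘ ρ)

    rotorDigit : ℕ → ℤ
    rotorDigit zero    = + back (arcIndex 0)
    rotorDigit (suc i) = + back (arcIndex (suc i)) + + fwd (arcIndex i)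

    rotorBound : ℕ → ℤ
    rotorBound zero    = + back (arcIndex 0)
    rotorBound (suc i) = + back (arcIndex (suc i)) - + (if arcIndex i <ᵇ x then 1 else 0)

    arcIndex-≥ : ∀ {i} → n ≤ i → arcIndex i ≡ 0
    arcIndex-≥ = extend-≥ 0 (toℕ ∘ ρ)

    back-idle : ∀ {i} → n ≤ i → back (arcIndex i) ≡ 0
    back-idle n≤i = trans (cong back (arcIndex-≥ n≤i)) (if-< 0<x)

    fwd-idle : ∀ {i} → n ≤ i → fwd (arcIndex i) ≡ 0
    fwd-idle n≤i = trans (cong fwd (arcIndex-≥ n≤i)) (if-< 0<x)

    value-rotorDigit : value (suc n) rotorDigit ≡ + x * gRot n x y ρ
    value-rotorDigit = sym (begin
      + x * gRot n x y ρ
        ≡⟨ ΣFin-* n (+ x) _ ⟨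
      ΣFin n (λ k → + x * gArc n x y (suc (toℕ k)) (toℕ (ρ k)))
        ≡⟨ ΣFin≡Σ< n {g = λ k → u k + v (suc k)} (λ k →
             trans (arc-value (toℕ<n k) (toℕ<n (ρ k)))
                   (cong (λ j → + back j * W (toℕ k) + + fwd j * W (suc (toℕ k))) (sym (extend-toℕ 0 (toℕ ∘ ρ) k)))) ⟩
      Σ< n (λ k → u k + v (suc k))
        ≡⟨ +-identityʳ _ ⟨
      Σ< n (λ k → u k + v (suc k)) + 0ℤ
        ≡⟨ cong (λ t → Σ< n (λ k → u k + v (suc k)) + t) boundary ⟨
      Σ< n (λ k → u k + v (suc k)) + (u n + v 0)
        ≡⟨ Σ<-reindex n u v ⟨
      Σ< (suc n) (λ i → u i + v i)
        ≡⟨ Σ<-cong (suc n) (λ i _ → split i) ⟨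
      Σ< (suc n) (λ i → rotorDigit i * W i)
        ≡⟨ +-identityʳ _ ⟨
      Σ< (suc n) (λ i → rotorDigit i * W i) + 0ℤ
        ≡⟨ cong (λ t → Σ< (suc n) (λ i → rotorDigit i * W i) + t * W (suc n)) top ⟨
      value (suc n) rotorDigit ∎)
      where
      open ≡-Reasoning
      W : ℕ → ℤ
      W = weight (suc n)
      u v : ℕ → ℤ
      u i       = + back (arcIndex i) * W i
      v zero    = 0ℤ
      v (suc i) = + fwd (arcIndex i) * W (suc i)
      split : ∀ i → rotorDigit i * W i ≡ u i + v i
      split zero    = sym (+-identityʳ (u 0))
      split (suc i) = *-distribʳ-+ (W (suc i)) (+ back (arcIndex (suc i))) (+ fwd (arcIndex i))
      boundary : u n + v 0 ≡ 0ℤ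
      boundary = trans (+-identityʳ (u n)) (cong (λ b → + b * W n) (back-idle ℕP.≤-refl))
      top : rotorDigit (suc n) ≡ 0ℤ
      top = cong₂ (λ b f → + b + + f) (back-idle (ℕP.n≤1+n n)) (fwd-idle ℕP.≤-refl)

    rotorDigit-nonneg : ∀ i → 0ℤ ℤ.≤ rotorDigit i
    rotorDigit-nonneg zero    = +≤+ z≤n
    rotorDigit-nonneg (suc i) = +≤+ z≤n

    rotorBound≤back : ∀ i → rotorBound i ℤ.≤ + back (arcIndex i)
    rotorBound≤back zero    = ≤-refl
    rotorBound≤back (suc i) = i≤j⇒i-k≤j (+ (if arcIndex i <ᵇ x then 1 else 0)) ≤-refl

    rotorBound-top : rotorBound (suc n) ≡ -1ℤ
    rotorBound-top = cong₂ (λ b s → + b - + s) (back-idle (ℕP.n≤1+n n))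
                      (trans (cong (λ j → if j <ᵇ x then 1 else 0) (arcIndex-≥ ℕP.≤-refl)) (if-< 0<x))

    rotorDigit-carryBounded : ∀ i → CarryBounded rotorDigit rotorBound i
    rotorDigit-carryBounded i with arcIndex i ℕ.<? x
    ... | yes j<x = inj₁ (≤-trans (rotorBound≤back i) (+≤+ (ℕP.≤-reflexive (if-< j<x))) , (begin
      + back (arcIndex (suc i)) + + fwd (arcIndex i)   ≡⟨ cong (λ f → + back (arcIndex (suc i)) + + f) (if-< j<x) ⟩
      + back (arcIndex (suc i)) + + arcIndex i         ≤⟨ +-monoʳ-≤ (+ back (arcIndex (suc i))) (i<j⇒i≤pred[j] (+<+ j<x)) ⟩
      + back (arcIndex (suc i)) + (-1ℤ + + x)          ≡⟨ regroup (+ back (arcIndex (suc i))) (+ x) ⟩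
      + back (arcIndex (suc i)) - + 1 + + x            ≡⟨ cong (λ s → + back (arcIndex (suc i)) - + s + + x) (if-< j<x) ⟨
      rotorBound (suc i) + + x                         ∎))
      where
      open ≤-Reasoning
      regroup : ∀ b x → b + (-1ℤ + x) ≡ b - 1ℤ + x
      regroup = solve-∀
    ... | no j≮x = inj₂ (≤-trans (rotorBound≤back i) (+≤+ (back≤y (arcIndex i))) ,
      ≤-reflexive (trans (cong (λ f → + back (arcIndex (suc i)) + + f) (if-≥ x≤j))
                         (sym (cong (λ s → + back (arcIndex (suc i)) - + s) (if-≥ x≤j)))))
      where
      x≤j : x ≤ arcIndex i
      x≤j = ℕP.≮⇒≥ j≮x

lemma8 : (n x y : ℕ) → 1 ≤ n → Coprime x y → 1 ≤ x → x < y → (v : ℕ)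
         → (c : Fin (suc n) → ℕ) (c' : ℤ) → IsC n x y v c c'
         → (c' ℤ.< 0ℤ → ¬ InGR n x y (+ v - F n x y))
           × (0ℤ ℤ.≤ c' → ¬ InGR n x y (+ v + F n x y))
lemma8 n x y _ x⊥y 1≤x x<y v c c' isC@(c<y , _) = no-minus , no-plus
  where
  instance
    x≢0 : NonZero x
    x≢0 = ℕ.>-nonZero 1≤x
    y≢0 : NonZero y
    y≢0 = ℕ.>-nonZero (ℕP.<-≤-trans 1≤x (ℕP.<⇒≤ x<y))
  open MixedRadix x y
  open PathGraph n x y

  balance : ∀ s {ρ} → gRot n x y ρ ≡ + v + s * F n x y →
            value (suc n) (shiftedDigits c c' s) ≡ value (suc n) (rotorDigit ρ)
  balance s {ρ} gρ≡v+sF =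
    trans (value-shiftedDigits isC s) (trans (cong (+ x *_) (sym gρ≡v+sF)) (sym (value-rotorDigit ρ)))

  top : ∀ s → shiftedDigits c c' s (suc n) ≡ c'
  top s = extend-≥ c' (λ k → + c k + s) ℕP.≤-refl

  no-minus : c' ℤ.< 0ℤ → ¬ InGR n x y (+ v - F n x y)
  no-minus c'<0 (ρ , gρ≡v-F) = <⇒≱ c'<0 (subst (0ℤ ℤ.≤_) (top -1ℤ)
    (top-digit-nonneg x⊥y (suc n) (shiftedDigits c c' -1ℤ) (rotorDigit ρ) c-1<y (rotorDigit-nonneg ρ)
      (balance -1ℤ (trans gρ≡v-F (cong (λ f → + v + f) (sym (-1*i≡-i (F n x y))))))))
    where
    c-1<y : ∀ k → shiftedDigits c c' -1ℤ (toℕ k) ℤ.< + y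
    c-1<y k = subst (ℤ._< + y) (sym (extend-toℕ c' _ k)) (≤-<-trans (i≤j⇒i-k≤j 1ℤ ≤-refl) (+<+ (c<y k)))

  no-plus : 0ℤ ℤ.≤ c' → ¬ InGR n x y (+ v + F n x y)
  no-plus 0≤c' (ρ , gρ≡v+F) = <⇒≱ (≤-<-trans c'≤-1 ℤ.-<+) 0≤c'
    where
    c+1>0 : ∀ k → 0ℤ ℤ.< shiftedDigits c c' 1ℤ (toℕ k)
    c+1>0 k = subst (0ℤ ℤ.<_) (sym (extend-toℕ c' _ k)) (+<+ (ℕP.m≤n+m 1 (c k)))
    c'≤-1 : c' ℤ.≤ -1ℤ
    c'≤-1 = subst₂ ℤ._≤_ (top 1ℤ) (rotorBound-top ρ)
      (top-digit-bounded x⊥y (suc n) (shiftedDigits c c' 1ℤ) (rotorDigit ρ) (rotorBound ρ) c+1>0 ≤-refl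
        (rotorDigit-carryBounded ρ) (balance 1ℤ (trans gρ≡v+F (cong (λ f → + v + f) (sym (*-identityˡ (F n x y)))))))
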